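{- Let $s$ be an expression of $L_{need,\oplus}$ with $\mathit{ExCv}(s)=1$. Then $s$ is should-convergent, i.e. for every $t$ with $s\xrightarrow{sr,*}t$ there is a standard reduction sequence from $t$ to a WHNF.
   Context: Expressions of $L_{need,\oplus}$: $s,t,r ::= x \mid \lambda x.s \mid (s\,t) \mid (s\oplus t) \mid \mathtt{let}\ env\ \mathtt{in}\ s$, with $env$ a (possibly empty) multiset of bindings $x_1=s_1,\dots,x_n=s_n$ with pairwise distinct $x_i$ and recursive scope; up to $\alpha$-equivalence. $\{x_i=s_{f(i)}\}_{i=j}^m$ abbreviates $x_j=s_{f(j)},\dots,x_m=s_{f(m)}$. $A ::= [\cdot]\mid (A\ s)$; reduction contexts $R ::= A \mid \mathtt{let}\ env\ \mathtt{in}\ A \mid \mathtt{let}\ env, \{x_i=A_i[x_{i+1}]\}_{i=1}^n, x_{n+1}=A_{n+1}\ \mathtt{in}\ A[x_1]$. Standard reduction $\xrightarrow{sr}$ (with $\xrightarrow{sr,*}$ its reflexive-transitive closure): (lbeta) $R[((\lambda x.s)\ t)] \to R[\mathtt{let}\ x=t\ \mathtt{in}\ s]$; (probl) $R[s\oplus t]\to R[s]$; (probr) $R[s\oplus t]\to R[t]$; (lapp) $R[((\mathtt{let}\ env\ \mathtt{in}\ s)\ t)] \to R[\mathtt{let}\ env\ \mathtt{in}\ (s\ t)]$; (llet-in) $\mathtt{let}\ env_1\ \mathtt{in}\ (\mathtt{let}\ env_2\ \mathtt{in}\ s) \to \mathtt{let}\ env_1,env_2\ \mathtt{in}\ s$;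 (llet-e) $\mathtt{let}\ \{x_i=A_i[x_{i+1}]\}_{i=1}^{n-1}, x_n=(\mathtt{let}\ env_1\ \mathtt{in}\ s), env_2\ \mathtt{in}\ A[x_1] \to \mathtt{let}\ \{x_i=A_i[x_{i+1}]\}_{i=1}^{n-1}, x_n=s, env_1, env_2\ \mathtt{in}\ A[x_1]$; (cp-in) $\mathtt{let}\ \{x_i=x_{i+1}\}_{i=1}^{n-1}, x_n=\lambda y.s, env\ \mathtt{in}\ A[x_1] \to \mathtt{let}\ \{x_i=x_{i+1}\}_{i=1}^{n-1}, x_n=\lambda y.s, env\ \mathtt{in}\ A[\lambda y.s]$; (cp-e) $\mathtt{let}\ \{x_i=A_i[x_{i+1}]\}_{i=1}^{n-1}, x_n=A_n[y_1], \{y_j=y_{j+1}\}_{j=1}^{m-1}, y_m=\lambda z.s, env\ \mathtt{in}\ A[x_1] \to$ the same with $x_n=A_n[\lambda z.s]$, where $A_n\ne[\cdot]$, $n,m\ge1$. A WHNF is an abstraction or $\mathtt{let}\ env\ \mathtt{in}\ \lambda x.s$; an evaluation is a finite standard reduction sequence ending in a WHNF; its prob-length is its number of (probl)/(probr) steps. $\mathit{ExCv}(s)=\sum 2^{ -m}$ over all evaluations of $s$ with prob-length $m$. -}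

module Defs where

open import Data.Nat using (ℕ; zero; suc; _+_; _∸_; _<ᵇ_)
open import Data.Bool using (if_then_else_)
open import Data.List using (List; []; _∷_; _++_; map; length)
open import Data.Maybe using (Maybe; just; nothing)
open import Data.Product using (Σ; ∃; _×_; _,_)
open import Relation.Binary.PropositionalEquality using (_≡_)
open import Relation.Nullary using (¬_)
open import Data.List.Relation.Unary.Linked using (Linked)
open import Data.List.Relation.Unary.All using (All)
open import Data.List.Relation.Unary.Unique.Propositional using (Unique)
open import Relation.Binary.Construct.Closure.ReflexiveTransitive using (Star)
open import Data.Rational using (ℚ; 0ℚ; ½; _*_; _-_; _≤_; _<_)
import Data.Rational as Q

-- Expressions of L_need,⊕ in de Bruijn representation.
-- (letE env s) binds (length env) variables at once with recursive
-- scope: inside env and s, index i < length env refers to the i-th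
-- binding of env, and index i ≥ length env refers to the free variable
-- i ∸ length env of the surrounding scope.  The multiset env is
-- represented by a list.

data Tm : Set where
  var  : ℕ → Tm
  lam  : Tm → Tm
  app  : Tm → Tm → Tm
  or   : Tm → Tm → Tm
  letE : List Tm → Tm → Tm

lift1 : (ℕ → ℕ) → ℕ → ℕ
lift1 ρ zero    = zero
lift1 ρ (suc x) = suc (ρ x)

liftN : ℕ → (ℕ → ℕ) → ℕ → ℕ
liftN zero    ρ = ρ
liftN (suc k) ρ = lift1 (liftN k ρ)

mutual
  ren : (ℕ → ℕ) → Tm → Tm
  ren ρ (var x)      = var (ρ x)
  ren ρ (lam t)      = lam (ren (lift1 ρ) t)
  ren ρ (app s t)    = app (ren ρ s) (ren ρ t)
  ren ρ (or s t)     = or (ren ρ s) (ren ρ t)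
  ren ρ (letE env t) = letE (renL (liftN (length env) ρ) env) (ren (liftN (length env) ρ) t)

  renL : (ℕ → ℕ) → List Tm → List Tm
  renL ρ []       = []
  renL ρ (t ∷ ts) = ren ρ t ∷ renL ρ ts

swapρ : ℕ → ℕ → ℕ → ℕ
swapρ a b i = if i <ᵇ a then b + i else (if i <ᵇ (a + b) then i ∸ a else i)

_!_ : List Tm → ℕ → Maybe Tm
[]       ! _     = nothing
(t ∷ ts) ! zero  = just t
(t ∷ ts) ! suc n = ts ! n

setAt : List Tm → ℕ → Tm → List Tm
setAt []       _       u = []
setAt (t ∷ ts) zero    u = u ∷ ts
setAt (t ∷ ts) (suc n) u = t ∷ setAt ts n u

last : ℕ → List ℕ → ℕ
last x []       = x
last x (y ∷ ys) = last y ys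

data ACtx : Set where
  hole : ACtx
  _·_  : ACtx → Tm → ACtx

plug : ACtx → Tm → Tm
plug hole    s = s
plug (A · t) s = app (plug A s) t

data Label : Set where
  lbeta probl probr lapp llet-in llet-e cp-in cp-e : Label

-- redexes that may occur in any reduction context R
data Red : Label → Tm → Tm → Set where
  r-lbeta : ∀ {s t} → Red lbeta (app (lam s) t) (letE (ren suc t ∷ []) s)
  r-probl : ∀ {s t} → Red probl (or s t) s
  r-probr : ∀ {s t} → Red probr (or s t) t
  r-lapp  : ∀ {env s t} →
            Red lapp (app (letE env s) t) (letE env (app s (ren (length env +_) t)))

Link : List Tm → ℕ → ℕ → Set
Link env x y = ∃ λ (A : ACtx) → env ! x ≡ just (plug A (var y))

HoleLink : List Tm → ℕ → ℕ → Set
HoleLink env x y = env ! x ≡ just (var y)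

data Step : Label → Tm → Tm → Set where
  st-A     : ∀ {l r r'} (A : ACtx) → Red l r r' → Step l (plug A r) (plug A r')
  st-letA  : ∀ {l r r'} env (A : ACtx) → Red l r r' →
             Step l (letE env (plug A r)) (letE env (plug A r'))
  -- R = let env, {x_i = A_i[x_{i+1}]}_{i=1}^n, x_{n+1} = A_{n+1} in A[x_1]
  st-chain : ∀ {l r r'} env (A A' : ACtx) (x : ℕ) (xs : List ℕ) →
             Linked (Link env) (x ∷ xs) → Unique (x ∷ xs) →
             env ! last x xs ≡ just (plug A' r) → Red l r r' →
             Step l (letE env (plug A (var x)))
                    (letE (setAt env (last x xs) (plug A' r')) (plug A (var x)))
  st-llet-in : ∀ env₁ env₂ s →
             Step llet-in (letE env₁ (letE env₂ s))
               (letE (map (ren (liftN (length env₁) (length env₂ +_))) env₁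
                       ++ map (ren (swapρ (length env₂) (length env₁))) env₂)
                     (ren (swapρ (length env₂) (length env₁)) s))
  st-llet-e : ∀ env (A : ACtx) (x : ℕ) (xs : List ℕ) env₁ s →
             Linked (Link env) (x ∷ xs) → Unique (x ∷ xs) →
             env ! last x xs ≡ just (letE env₁ s) →
             Step llet-e (letE env (plug A (var x)))
               (letE (setAt (map (ren (liftN (length env) (length env₁ +_))) env)
                            (last x xs)
                            (ren (swapρ (length env₁) (length env)) s)
                       ++ map (ren (swapρ (length env₁) (length env))) env₁)
                     (ren (liftN (length env) (length env₁ +_)) (plug A (var x))))
  st-cp-in : ∀ env (A : ACtx) (x : ℕ) (xs : List ℕ) s →
             Linked (HoleLink env) (x ∷ xs) → Unique (x ∷ xs) →
             env ! last x xs ≡ just (lam s) →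
             Step cp-in (letE env (plug A (var x))) (letE env (plug A (lam s)))
  st-cp-e  : ∀ env (A Aₙ : ACtx) (x : ℕ) (xs : List ℕ) (y : ℕ) (ys : List ℕ) s →
             ¬ (Aₙ ≡ hole) →
             Linked (Link env) (x ∷ xs) →
             env ! last x xs ≡ just (plug Aₙ (var y)) →
             Linked (HoleLink env) (y ∷ ys) →
             env ! last y ys ≡ just (lam s) →
             Unique ((x ∷ xs) ++ (y ∷ ys)) →
             Step cp-e (letE env (plug A (var x)))
                       (letE (setAt env (last x xs) (plug Aₙ (lam s))) (plug A (var x)))

_⟶sr_ : Tm → Tm → Set
s ⟶sr t = ∃ λ l → Step l s t

_⟶sr*_ : Tm → Tm → Set
_⟶sr*_ = Star _⟶sr_

data WHNF : Tm → Set where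
  whnf-lam : ∀ s → WHNF (lam s)
  whnf-let : ∀ env s → WHNF (letE env (lam s))

-- Evaluations.  An evaluation of s is represented by its trace: the list
-- of (rule label, resulting expression) of each step, ending in a WHNF.

Trace : Set
Trace = List (Label × Tm)

data IsEval : Tm → Trace → Set where
  ev-done : ∀ {s} → WHNF s → IsEval s []
  ev-step : ∀ {s t l tr} → Step l s t → IsEval t tr → IsEval s ((l , t) ∷ tr)

isProb : Label → ℕ
isProb probl = 1
isProb probr = 1
isProb _     = 0

probLength : Trace → ℕ
probLength []             = 0
probLength ((l , _) ∷ tr) = isProb l + probLength tr

half^ : ℕ → ℚ
half^ zero    = Q.1ℚ
half^ (suc m) = ½ * half^ m

sumW : List Trace → ℚ
sumW []         = 0ℚ
sumW (tr ∷ trs) = half^ (probLength tr) Q.+ sumW trs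

-- ExCv(s) = q : the series Σ_{evaluations} 2^(-prob-length) of
-- nonnegative terms has sum q, i.e. q is the supremum of the sums over
-- finite sets of (pairwise distinct) evaluations of s.
ExCv≡ : Tm → ℚ → Set
ExCv≡ s q =
  (∀ (trs : List Trace) → Unique trs → All (IsEval s) trs → sumW trs ≤ q)
  × (∀ (ε : ℚ) → 0ℚ < ε →
       ∃ λ (trs : List Trace) → Unique trs × All (IsEval s) trs × (q - ε) < sumW trs)

ShouldConv : Tm → Set
ShouldConv s = ∀ t → s ⟶sr* t → ∃ λ t' → (t ⟶sr* t') × WHNF t'

-- Standard reduction is deterministic except at a choice s ⊕ t, where an
-- expression has exactly one (probl)- and one (probr)-step.  So the
-- evaluations of s form a binary tree in which a (prob) edge halves the
-- weight, and any finite set of them has weight at most 1.  If s →sr,* t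
-- with m (prob)-steps and t has no evaluation, the subtree of t is empty, so
-- every finite set of evaluations of s has weight at most 1 - 2^-m; this
-- contradicts ExCv(s) = 1.  Determinism of the let-rules rests on the chain of
-- bindings they follow being the unique maximal one from the head variable.
module Submission where

open import Defs
open import Data.Empty using (⊥; ⊥-elim)
open import Data.Unit using (⊤; tt)
open import Data.Nat as ℕ using (ℕ; zero; suc)
open import Data.List using (List; []; _∷_; _++_; map; length)
import Data.List.Properties as List
open import Data.List.Extrema.Nat using (f[xs]≤f[argmax])
open import Data.List.Relation.Unary.All as All using (All; []; _∷_)
import Data.List.Relation.Unary.All.Properties as Allₚ
open import Data.List.Relation.Unary.AllPairs using ([]; _∷_)
open import Data.List.Relation.Unary.Linked as Linked using (Linked; _∷_)
open import Data.List.Relation.Unary.Unique.Propositional using (Unique)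
import Data.List.Relation.Unary.Unique.Propositional.Properties as Uniqueₚ
open import Data.Maybe using (just)
import Data.Maybe.Properties as Maybe
open import Data.Product using (∃; _×_; _,_; proj₁; proj₂)
open import Data.Sum as Sum using (_⊎_; inj₁; inj₂)
open import Data.Rational using (0ℚ; 1ℚ; ½; _+_; _*_; _-_; _≤_; _<_)
import Data.Rational.Properties as ℚ
open import Data.Rational.Solver using (module +-*-Solver)
open import Algebra.Bundles using (CommutativeMonoid)
open import Algebra.Properties.CommutativeSemigroup
  (CommutativeMonoid.commutativeSemigroup ℚ.+-0-commutativeMonoid) using (x∙yz≈y∙xz)
open import Function using (_∘_)
open import Relation.Binary.Construct.Closure.ReflexiveTransitive using (ε; _◅_)
open import Relation.Binary.PropositionalEquality
open import Relation.Nullary using (¬_)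

IsApp⊕ : Tm → Set
IsApp⊕ (app _ _) = ⊤
IsApp⊕ (or _ _)  = ⊤
IsApp⊕ _         = ⊥

IsVar : Tm → Set
IsVar (var _) = ⊤
IsVar _       = ⊥

head : Tm → Tm
head (app s _) = head s
head s         = s

plug-redex-isApp⊕ : ∀ A {l r v t} → Red l r v → plug A r ≡ t → IsApp⊕ t
plug-redex-isApp⊕ (A · _) _       refl = tt
plug-redex-isApp⊕ hole    r-lbeta refl = tt
plug-redex-isApp⊕ hole    r-probl refl = tt
plug-redex-isApp⊕ hole    r-probr refl = tt
plug-redex-isApp⊕ hole    r-lapp  refl = tt

plug-redex-head : ∀ A {l r v} → Red l r v → ¬ IsVar (head (plug A r))
plug-redex-head (A · _) red = plug-redex-head A red
plug-redex-head hole r-lbeta ()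
plug-redex-head hole r-probl ()
plug-redex-head hole r-probr ()
plug-redex-head hole r-lapp  ()

plug-var-head : ∀ A x {t} → plug A (var x) ≡ t → IsVar (head t)
plug-var-head hole    x refl = tt
plug-var-head (A · _) x refl = plug-var-head A x refl

plug-var≢plug-redex : ∀ A {x} B {l r v} → Red l r v → plug A (var x) ≢ plug B r
plug-var≢plug-redex A {x} B red eq = plug-redex-head B red (plug-var-head A x eq)

app-injective : ∀ {s t s′ t′} → app s t ≡ app s′ t′ → s ≡ s′ × t ≡ t′
app-injective refl = refl , refl

letE-injective : ∀ {env s env′ s′} → letE env s ≡ letE env′ s′ → env ≡ env′ × s ≡ s′
letE-injective refl = refl , refl

plug-var-injective : ∀ A B {x y} → plug A (var x) ≡ plug B (var y) → A ≡ B × x ≡ y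
plug-var-injective hole    hole    refl = refl , refl
plug-var-injective hole    (_ · _) ()
plug-var-injective (_ · _) hole    ()
plug-var-injective (A · _) (B · _) eq with app-injective eq
... | eq′ , refl with plug-var-injective A B eq′
...   | refl , refl = refl , refl

plug-var-hole : ∀ A {x y} → plug A (var x) ≡ var y → A ≡ hole
plug-var-hole hole _ = refl

redex-not-app-of-redex : ∀ B {l r v l′ r′ v′ t} → Red l r v → Red l′ r′ v′ →
                         r ≢ app (plug B r′) t
redex-not-app-of-redex B r-lbeta red′ eq = plug-redex-isApp⊕ B red′ (sym (proj₁ (app-injective eq)))
redex-not-app-of-redex B r-lapp  red′ eq = plug-redex-isApp⊕ B red′ (sym (proj₁ (app-injective eq)))
redex-not-app-of-redex B r-probl _ ()
redex-not-app-of-redex B r-probr _ ()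

plug-redex-injective : ∀ A B {l r v l′ r′ v′} → Red l r v → Red l′ r′ v′ →
                       plug A r ≡ plug B r′ → A ≡ B × r ≡ r′
plug-redex-injective hole    hole    _   _    eq = refl , eq
plug-redex-injective hole    (B · _) red red′ eq = ⊥-elim (redex-not-app-of-redex B red red′ eq)
plug-redex-injective (A · _) hole    red red′ eq = ⊥-elim (redex-not-app-of-redex A red′ red (sym eq))
plug-redex-injective (A · _) (B · _) red red′ eq with app-injective eq
... | eq′ , refl with plug-redex-injective A B red red′ eq′
...   | refl , refl = refl , refl

-- Determinism of standard reduction up to choice

data Coherent : Label × Tm → Label × Tm → Set where
  same    : ∀ {h} → Coherent h h
  choiceˡ : ∀ {a b} → Coherent (probl , a) (probr , b)
  choiceʳ : ∀ {a b} → Coherent (probr , a) (probl , b)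

Coherent-map : ∀ (f : Tm → Tm) {l v l′ v′} →
               Coherent (l , v) (l′ , v′) → Coherent (l , f v) (l′ , f v′)
Coherent-map f same    = same
Coherent-map f choiceˡ = choiceˡ
Coherent-map f choiceʳ = choiceʳ

Red-coherent : ∀ {l l′ r v v′} → Red l r v → Red l′ r v′ → Coherent (l , v) (l′ , v′)
Red-coherent r-lbeta r-lbeta = same
Red-coherent r-probl r-probl = same
Red-coherent r-probl r-probr = choiceˡ
Red-coherent r-probr r-probl = choiceʳ
Red-coherent r-probr r-probr = same
Red-coherent r-lapp  r-lapp  = same

NoLinkFrom : List Tm → ℕ → Set
NoLinkFrom env z = ∀ y → ¬ Link env z y

NoLinkFrom-nonVarHead : ∀ {env z t} → env ! z ≡ just t → ¬ IsVar (head t) → NoLinkFrom env z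
NoLinkFrom-nonVarHead e ¬var y (B , e′) =
  ¬var (plug-var-head B y (Maybe.just-injective (trans (sym e′) e)))

Link-functional : ∀ {env z y y′} → Link env z y → Link env z y′ → y ≡ y′
Link-functional (A , e) (B , e′) =
  proj₂ (plug-var-injective A B (Maybe.just-injective (trans (sym e) e′)))

HoleLink⇒Link : ∀ {env z y} → HoleLink env z y → Link env z y
HoleLink⇒Link e = hole , e

nonHole⇒¬HoleLink : ∀ {env z y} Aₙ → Aₙ ≢ hole → env ! z ≡ just (plug Aₙ (var y)) →
                    ¬ HoleLink env z y
nonHole⇒¬HoleLink Aₙ Aₙ≢hole e h =
  Aₙ≢hole (plug-var-hole Aₙ (Maybe.just-injective (trans (sym e) h)))

maximal-chain-unique : ∀ {env x} xs ys →
                       Linked (Link env) (x ∷ xs) → NoLinkFrom env (last x xs) →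
                       Linked (Link env) (x ∷ ys) → NoLinkFrom env (last x ys) → xs ≡ ys
maximal-chain-unique []       []       _          _   _            _   = refl
maximal-chain-unique []       (y ∷ _)  _          end (link ∷ _)   _   = ⊥-elim (end y link)
maximal-chain-unique (y ∷ _)  []       (link ∷ _) _   _            end = ⊥-elim (end y link)
maximal-chain-unique {env} (y ∷ xs) (_ ∷ ys) (link ∷ chain) end (link′ ∷ chain′) end′
  with Link-functional {env} link link′
... | refl = cong (y ∷_) (maximal-chain-unique {env} xs ys chain end chain′ end′)

last-++-∷ : ∀ x xs y ys → last x (xs ++ y ∷ ys) ≡ last y ys
last-++-∷ x []       y ys = refl
last-++-∷ x (z ∷ xs) y ys = last-++-∷ z xs y ys

Linked-junction : ∀ {R : ℕ → ℕ → Set} x xs y ys →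
                  Linked R (x ∷ xs ++ y ∷ ys) → R (last x xs) y
Linked-junction x []       y ys (r ∷ _)  = r
Linked-junction x (z ∷ xs) y ys (_ ∷ rs) = Linked-junction z xs y ys rs

Linked-++ : ∀ {R : ℕ → ℕ → Set} x xs y ys →
            Linked R (x ∷ xs) → R (last x xs) y → Linked R (y ∷ ys) →
            Linked R (x ∷ xs ++ y ∷ ys)
Linked-++ x []       y ys _        r rs′ = r ∷ rs′
Linked-++ x (z ∷ xs) y ys (r ∷ rs) r′ rs′ = r ∷ Linked-++ z xs y ys rs r′ rs′

++-∷-trichotomy : ∀ (xs ys xs′ ys′ : List ℕ) y y′ → xs ++ y ∷ ys ≡ xs′ ++ y′ ∷ ys′ →
                  (xs ≡ xs′ × y ≡ y′ × ys ≡ ys′)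
                  ⊎ (∃ λ m → xs′ ≡ xs ++ y ∷ m × ys ≡ m ++ y′ ∷ ys′)
                  ⊎ (∃ λ m → xs ≡ xs′ ++ y′ ∷ m × ys′ ≡ m ++ y ∷ ys)
++-∷-trichotomy []       ys []        ys′ y y′ refl = inj₁ (refl , refl , refl)
++-∷-trichotomy []       ys (_ ∷ xs′) ys′ y y′ refl = inj₂ (inj₁ (xs′ , refl , refl))
++-∷-trichotomy (_ ∷ xs) ys []        ys′ y y′ refl = inj₂ (inj₂ (xs , refl , refl))
++-∷-trichotomy (z ∷ xs) ys (_ ∷ xs′) ys′ y y′ eq with List.∷-injective eq
... | refl , eq′ with ++-∷-trichotomy xs ys xs′ ys′ y y′ eq′
...   | inj₁ (refl , p , q)            = inj₁ (refl , p , q)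
...   | inj₂ (inj₁ (m , refl , q))     = inj₂ (inj₁ (m , refl , q))
...   | inj₂ (inj₂ (m , refl , q))     = inj₂ (inj₂ (m , refl , q))

record MaximalChain (env : List Tm) (x : ℕ) : Set where
  field
    rest        : List ℕ
    linked      : Linked (Link env) (x ∷ rest)
    maximal     : NoLinkFrom env (last x rest)
    end         : Tm
    end-binding : env ! last x rest ≡ just end

open MaximalChain

SameMaximalChain : ∀ {env x} → MaximalChain env x → MaximalChain env x → Set
SameMaximalChain c c′ = rest c ≡ rest c′ × end c ≡ end c′

MaximalChain-unique : ∀ {env x} (c c′ : MaximalChain env x) → SameMaximalChain c c′
MaximalChain-unique {env} {x} c c′ = rest≡ , Maybe.just-injective (begin
  just (end c)            ≡⟨ sym (end-binding c) ⟩
  env ! last x (rest c)   ≡⟨ cong (λ zs → env ! last x zs) rest≡ ⟩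
  env ! last x (rest c′)  ≡⟨ end-binding c′ ⟩
  just (end c′)           ∎)
  where
  open ≡-Reasoning
  rest≡ = maximal-chain-unique {env} (rest c) (rest c′)
                                (linked c) (maximal c) (linked c′) (maximal c′)

-- The rules whose redex in let env in A[x] is found at the end of the
-- chain of bindings starting from x.
data ChainStep (env : List Tm) (A : ACtx) (x : ℕ) : Label → Tm → Set where
  chain-red    : ∀ {l r r′} (A′ : ACtx) xs → Linked (Link env) (x ∷ xs) →
                 env ! last x xs ≡ just (plug A′ r) → Red l r r′ →
                 ChainStep env A x l (letE (setAt env (last x xs) (plug A′ r′)) (plug A (var x)))
  chain-llet-e : ∀ xs env₁ s → Linked (Link env) (x ∷ xs) →
                 env ! last x xs ≡ just (letE env₁ s) →
                 ChainStep env A x llet-e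
                   (letE (setAt (map (ren (liftN (length env) (length env₁ ℕ.+_))) env)
                                (last x xs)
                                (ren (swapρ (length env₁) (length env)) s)
                           ++ map (ren (swapρ (length env₁) (length env))) env₁)
                         (ren (liftN (length env) (length env₁ ℕ.+_)) (plug A (var x))))
  chain-cp-in  : ∀ xs s → Linked (HoleLink env) (x ∷ xs) → env ! last x xs ≡ just (lam s) →
                 ChainStep env A x cp-in (letE env (plug A (lam s)))
  chain-cp-e   : ∀ (Aₙ : ACtx) xs y ys s → Aₙ ≢ hole →
                 Linked (Link env) (x ∷ xs) → env ! last x xs ≡ just (plug Aₙ (var y)) →
                 Linked (HoleLink env) (y ∷ ys) → env ! last y ys ≡ just (lam s) →
                 ChainStep env A x cp-e (letE (setAt env (last x xs) (plug Aₙ (lam s))) (plug A (var x)))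

ChainStep-maximalChain : ∀ {env A x l v} → ChainStep env A x l v → MaximalChain env x
ChainStep-maximalChain {env} (chain-red A′ xs chain e red) =
  record { rest = xs ; linked = chain ; maximal = NoLinkFrom-nonVarHead {env} e (plug-redex-head A′ red)
         ; end = _ ; end-binding = e }
ChainStep-maximalChain {env} (chain-llet-e xs _ _ chain e) =
  record { rest = xs ; linked = chain ; maximal = NoLinkFrom-nonVarHead {env} e λ ()
         ; end = _ ; end-binding = e }
ChainStep-maximalChain {env} (chain-cp-in xs _ chain e) =
  record { rest = xs ; linked = Linked.map (HoleLink⇒Link {env}) chain
         ; maximal = NoLinkFrom-nonVarHead {env} e λ ()
         ; end = _ ; end-binding = e }
ChainStep-maximalChain {env} {x = x} (chain-cp-e Aₙ xs y ys _ _ chain e hole-chain e′) =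
  record { rest = xs ++ y ∷ ys
         ; linked = Linked-++ x xs y ys chain (Aₙ , e) (Linked.map (HoleLink⇒Link {env}) hole-chain)
         ; maximal = NoLinkFrom-nonVarHead {env} end-binding′ λ ()
         ; end = _ ; end-binding = end-binding′ }
  where
  end-binding′ = trans (cong (env !_) (last-++-∷ x xs y ys)) e′

-- A (cp-e) chain x … xₙ, y … yₘ splits at its last non-hole link.
cp-e-junction-unique : ∀ {env x y y′ Aₙ Aₙ′} xs xs′ ys ys′ → Aₙ ≢ hole → Aₙ′ ≢ hole →
                       env ! last x xs ≡ just (plug Aₙ (var y)) →
                       env ! last x xs′ ≡ just (plug Aₙ′ (var y′)) →
                       Linked (HoleLink env) (y ∷ ys) → Linked (HoleLink env) (y′ ∷ ys′) →
                       xs ++ y ∷ ys ≡ xs′ ++ y′ ∷ ys′ → xs ≡ xs′ × Aₙ ≡ Aₙ′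
cp-e-junction-unique {env} {x} {y} {y′} {Aₙ} {Aₙ′} xs xs′ ys ys′ Aₙ≢hole Aₙ′≢hole e e′ chain chain′ rest≡
  with ++-∷-trichotomy xs ys xs′ ys′ y y′ rest≡
... | inj₁ (refl , refl , refl) =
  refl , proj₁ (plug-var-injective Aₙ Aₙ′ (Maybe.just-injective (trans (sym e) e′)))
... | inj₂ (inj₁ (m , refl , refl)) =
  ⊥-elim (nonHole⇒¬HoleLink {env} Aₙ′ Aₙ′≢hole (trans (cong (env !_) (sym (last-++-∷ x xs y m))) e′)
                            (Linked-junction y m y′ ys′ chain))
... | inj₂ (inj₂ (m , refl , refl)) =
  ⊥-elim (nonHole⇒¬HoleLink {env} Aₙ Aₙ≢hole (trans (cong (env !_) (sym (last-++-∷ x xs′ y′ m))) e)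
                            (Linked-junction y′ m y ys chain′))

sameMaximalChain⇒Coherent : ∀ {env A x l l′ v v′}
                            (c : ChainStep env A x l v) (c′ : ChainStep env A x l′ v′) →
                            SameMaximalChain (ChainStep-maximalChain c) (ChainStep-maximalChain c′) →
                            Coherent (l , v) (l′ , v′)
sameMaximalChain⇒Coherent {env} {A} {x} (chain-red A₁ xs _ _ red) (chain-red A₂ _ _ _ red′) (refl , end≡)
  with plug-redex-injective A₁ A₂ red red′ end≡
... | refl , refl = Coherent-map (λ w → letE (setAt env (last x xs) (plug A₁ w)) (plug A (var x)))
                                 (Red-coherent red red′)
sameMaximalChain⇒Coherent (chain-red A₁ _ _ _ red) (chain-llet-e _ _ _ _ _) (_ , end≡) =
  ⊥-elim (plug-redex-isApp⊕ A₁ red end≡)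
sameMaximalChain⇒Coherent (chain-red A₁ _ _ _ red) (chain-cp-in _ _ _ _) (_ , end≡) =
  ⊥-elim (plug-redex-isApp⊕ A₁ red end≡)
sameMaximalChain⇒Coherent (chain-red A₁ _ _ _ red) (chain-cp-e _ _ _ _ _ _ _ _ _ _) (_ , end≡) =
  ⊥-elim (plug-redex-isApp⊕ A₁ red end≡)
sameMaximalChain⇒Coherent (chain-llet-e _ _ _ _ _) (chain-red A₂ _ _ _ red′) (_ , end≡) =
  ⊥-elim (plug-redex-isApp⊕ A₂ red′ (sym end≡))
sameMaximalChain⇒Coherent (chain-llet-e _ _ _ _ _) (chain-llet-e _ _ _ _ _) (refl , refl) = same
sameMaximalChain⇒Coherent (chain-llet-e _ _ _ _ _) (chain-cp-in _ _ _ _) (_ , ())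
sameMaximalChain⇒Coherent (chain-llet-e _ _ _ _ _) (chain-cp-e _ _ _ _ _ _ _ _ _ _) (_ , ())
sameMaximalChain⇒Coherent (chain-cp-in _ _ _ _) (chain-red A₂ _ _ _ red′) (_ , end≡) =
  ⊥-elim (plug-redex-isApp⊕ A₂ red′ (sym end≡))
sameMaximalChain⇒Coherent (chain-cp-in _ _ _ _) (chain-llet-e _ _ _ _ _) (_ , ())
sameMaximalChain⇒Coherent (chain-cp-in _ _ _ _) (chain-cp-in _ _ _ _) (refl , refl) = same
sameMaximalChain⇒Coherent {env} {x = x}
    (chain-cp-in _ _ hole-chain _) (chain-cp-e Aₙ xs y ys _ Aₙ≢hole _ e _ _) (refl , _) =
  ⊥-elim (nonHole⇒¬HoleLink {env} Aₙ Aₙ≢hole e (Linked-junction x xs y ys hole-chain))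
sameMaximalChain⇒Coherent (chain-cp-e _ _ _ _ _ _ _ _ _ _) (chain-red A₂ _ _ _ red′) (_ , end≡) =
  ⊥-elim (plug-redex-isApp⊕ A₂ red′ (sym end≡))
sameMaximalChain⇒Coherent (chain-cp-e _ _ _ _ _ _ _ _ _ _) (chain-llet-e _ _ _ _ _) (_ , ())
sameMaximalChain⇒Coherent {env} {x = x}
    (chain-cp-e Aₙ xs y ys _ Aₙ≢hole _ e _ _) (chain-cp-in _ _ hole-chain _) (refl , _) =
  ⊥-elim (nonHole⇒¬HoleLink {env} Aₙ Aₙ≢hole e (Linked-junction x xs y ys hole-chain))
sameMaximalChain⇒Coherent {env} {x = x}
    (chain-cp-e Aₙ xs y ys _ Aₙ≢hole _ e chain _) (chain-cp-e Aₙ′ xs′ y′ ys′ _ Aₙ′≢hole _ e′ chain′ _)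
    (rest≡ , end≡)
  with cp-e-junction-unique {env} {x} xs xs′ ys ys′ Aₙ≢hole Aₙ′≢hole e e′ chain chain′ rest≡ | end≡
... | refl , refl | refl = same

ChainStep-coherent : ∀ {env A x l l′ v v′} → ChainStep env A x l v → ChainStep env A x l′ v′ →
                     Coherent (l , v) (l′ , v′)
ChainStep-coherent c c′ =
  sameMaximalChain⇒Coherent c c′
    (MaximalChain-unique (ChainStep-maximalChain c) (ChainStep-maximalChain c′))

data StepView : Label → Tm → Tm → Set where
  in-A        : ∀ {l r r′} A → Red l r r′ → StepView l (plug A r) (plug A r′)
  in-let      : ∀ {l r r′} env A → Red l r r′ →
                StepView l (letE env (plug A r)) (letE env (plug A r′))
  along-chain : ∀ {l v} env A x → ChainStep env A x l v → StepView l (letE env (plug A (var x))) v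
  let-in      : ∀ env₁ env₂ s →
                StepView llet-in (letE env₁ (letE env₂ s))
                  (letE (map (ren (liftN (length env₁) (length env₂ ℕ.+_))) env₁
                          ++ map (ren (swapρ (length env₂) (length env₁))) env₂)
                        (ren (swapρ (length env₂) (length env₁)) s))

stepView : ∀ {l u v} → Step l u v → StepView l u v
stepView (st-A A red)                                  = in-A A red
stepView (st-letA env A red)                           = in-let env A red
stepView (st-chain env A A′ x xs chain _ e red)        = along-chain env A x (chain-red A′ xs chain e red)
stepView (st-llet-in env₁ env₂ s)                      = let-in env₁ env₂ s
stepView (st-llet-e env A x xs env₁ s chain _ e)       = along-chain env A x (chain-llet-e xs env₁ s chain e)
stepView (st-cp-in env A x xs s chain _ e)             = along-chain env A x (chain-cp-in xs s chain e)
stepView (st-cp-e env A Aₙ x xs y ys s Aₙ≢hole chain e hole-chain e′ _) =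
  along-chain env A x (chain-cp-e Aₙ xs y ys s Aₙ≢hole chain e hole-chain e′)

StepView-coherent : ∀ {l l′ u u′ v v′} → StepView l u v → StepView l′ u′ v′ → u ≡ u′ →
                    Coherent (l , v) (l′ , v′)
StepView-coherent (in-A A red) (in-A B red′) eq with plug-redex-injective A B red red′ eq
... | refl , refl = Coherent-map (plug A) (Red-coherent red red′)
StepView-coherent (in-A A red) (in-let _ _ _)         eq = ⊥-elim (plug-redex-isApp⊕ A red eq)
StepView-coherent (in-A A red) (along-chain _ _ _ _)  eq = ⊥-elim (plug-redex-isApp⊕ A red eq)
StepView-coherent (in-A A red) (let-in _ _ _)         eq = ⊥-elim (plug-redex-isApp⊕ A red eq)
StepView-coherent (in-let _ _ _)        (in-A B red′) eq = ⊥-elim (plug-redex-isApp⊕ B red′ (sym eq))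
StepView-coherent (along-chain _ _ _ _) (in-A B red′) eq = ⊥-elim (plug-redex-isApp⊕ B red′ (sym eq))
StepView-coherent (let-in _ _ _)        (in-A B red′) eq = ⊥-elim (plug-redex-isApp⊕ B red′ (sym eq))
StepView-coherent (in-let env A red) (in-let _ B red′) eq with letE-injective eq
... | refl , eq′ with plug-redex-injective A B red red′ eq′
...   | refl , refl = Coherent-map (λ w → letE env (plug A w)) (Red-coherent red red′)
StepView-coherent (in-let _ A red) (along-chain _ B _ _) eq =
  ⊥-elim (plug-var≢plug-redex B A red (sym (proj₂ (letE-injective eq))))
StepView-coherent (in-let _ A red) (let-in _ _ _) eq =
  ⊥-elim (plug-redex-isApp⊕ A red (proj₂ (letE-injective eq)))
StepView-coherent (along-chain _ A _ _) (in-let _ B red′) eq =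
  ⊥-elim (plug-var≢plug-redex A B red′ (proj₂ (letE-injective eq)))
StepView-coherent (let-in _ _ _) (in-let _ B red′) eq =
  ⊥-elim (plug-redex-isApp⊕ B red′ (sym (proj₂ (letE-injective eq))))
StepView-coherent (along-chain _ A _ c) (along-chain _ B _ c′) eq with letE-injective eq
... | refl , eq′ with plug-var-injective A B eq′
...   | refl , refl = ChainStep-coherent c c′
StepView-coherent (along-chain _ A x _) (let-in _ _ _) eq =
  ⊥-elim (plug-var-head A x (proj₂ (letE-injective eq)))
StepView-coherent (let-in _ _ _) (along-chain _ B y _) eq =
  ⊥-elim (plug-var-head B y (sym (proj₂ (letE-injective eq))))
StepView-coherent (let-in _ _ _) (let-in _ _ _) refl = same

Step-coherent : ∀ {l l′ u v v′} → Step l u v → Step l′ u v′ → Coherent (l , v) (l′ , v′)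
Step-coherent st st′ = StepView-coherent (stepView st) (stepView st′) refl

WHNF-noStepView : ∀ {l u u′ v} → WHNF u → StepView l u′ v → u′ ≢ u
WHNF-noStepView (whnf-lam _)   (in-A A red)          eq = plug-redex-isApp⊕ A red eq
WHNF-noStepView (whnf-lam _)   (in-let _ _ _)        ()
WHNF-noStepView (whnf-lam _)   (along-chain _ _ _ _) ()
WHNF-noStepView (whnf-lam _)   (let-in _ _ _)        ()
WHNF-noStepView (whnf-let _ _) (in-A A red)          eq = plug-redex-isApp⊕ A red eq
WHNF-noStepView (whnf-let _ _) (in-let _ A red)      eq = plug-redex-isApp⊕ A red (proj₂ (letE-injective eq))
WHNF-noStepView (whnf-let _ _) (along-chain _ A x _) eq = plug-var-head A x (proj₂ (letE-injective eq))
WHNF-noStepView (whnf-let _ _) (let-in _ _ _)        ()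

WHNF-irreducible : ∀ {l u v} → WHNF u → ¬ Step l u v
WHNF-irreducible w st = WHNF-noStepView w (stepView st) refl

probl⇒probr : ∀ {u a} → Step probl u a → ∃ λ b → Step probr u b
probl⇒probr (st-A A r-probl)                     = _ , st-A A r-probr
probl⇒probr (st-letA env A r-probl)              = _ , st-letA env A r-probr
probl⇒probr (st-chain env A A′ x xs chain uq e r-probl) = _ , st-chain env A A′ x xs chain uq e r-probr

probr⇒probl : ∀ {u b} → Step probr u b → ∃ λ a → Step probl u a
probr⇒probl (st-A A r-probr)                     = _ , st-A A r-probl
probr⇒probl (st-letA env A r-probr)              = _ , st-letA env A r-probl
probr⇒probl (st-chain env A A′ x xs chain uq e r-probr) = _ , st-chain env A A′ x xs chain uq e r-probl

OnlyStep : Tm → Label × Tm → Set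
OnlyStep u h = ∀ {l v} → Step l u v → (l , v) ≡ h

OnlySteps : Tm → Label × Tm → Label × Tm → Set
OnlySteps u h₁ h₂ = ∀ {l v} → Step l u v → (l , v) ≡ h₁ ⊎ (l , v) ≡ h₂

data Branching (u : Tm) : Set where
  deterministic : ∀ {l v} → isProb l ≡ 0 → Step l u v → OnlyStep u (l , v) → Branching u
  choice        : ∀ {a b} → Step probl u a → OnlySteps u (probl , a) (probr , b) → Branching u

Coherent-deterministic : ∀ {l v h} → isProb l ≡ 0 → Coherent (l , v) h → h ≡ (l , v)
Coherent-deterministic _ same = refl

Coherent-choice : ∀ {a b h} → Coherent (probl , a) h → Coherent (probr , b) h →
                  h ≡ (probl , a) ⊎ h ≡ (probr , b)
Coherent-choice same    _    = inj₁ refl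
Coherent-choice choiceˡ same = inj₂ refl

deterministic-branching : ∀ {l u v} → isProb l ≡ 0 → Step l u v → Branching u
deterministic-branching z st = deterministic z st (Coherent-deterministic z ∘ Step-coherent st)

choice-branching : ∀ {u a b} → Step probl u a → Step probr u b → Branching u
choice-branching sa sb =
  choice sa (λ st → Coherent-choice (Step-coherent sa st) (Step-coherent sb st))

branching : ∀ {l u v} → Step l u v → Branching u
branching {probl}   st = choice-branching st (proj₂ (probl⇒probr st))
branching {probr}   st = choice-branching (proj₂ (probr⇒probl st)) st
branching {lbeta}   st = deterministic-branching refl st
branching {lapp}    st = deterministic-branching refl st
branching {llet-in} st = deterministic-branching refl st
branching {llet-e}  st = deterministic-branching refl st
branching {cp-in}   st = deterministic-branching refl st
branching {cp-e}    st = deterministic-branching refl st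

-- Weights of finite sets of evaluations

half^-+ : ∀ a m → half^ (a ℕ.+ m) ≡ half^ a * half^ m
half^-+ zero    m = sym (ℚ.*-identityˡ _)
half^-+ (suc a) m = trans (cong (½ *_) (half^-+ a m)) (sym (ℚ.*-assoc ½ (half^ a) (half^ m)))

half^-positive : ∀ m → 0ℚ < half^ m
half^-positive zero    = ℚ.positive⁻¹ 1ℚ
half^-positive (suc m) = subst (_< ½ * half^ m) (ℚ.*-zeroʳ ½) (ℚ.*-monoʳ-<-pos ½ (half^-positive m))

sumW-map-∷ : ∀ l v E → sumW (map ((l , v) ∷_) E) ≡ half^ (isProb l) * sumW E
sumW-map-∷ l v []       = sym (ℚ.*-zeroʳ (half^ (isProb l)))
sumW-map-∷ l v (tr ∷ E) = trans (cong₂ _+_ (half^-+ (isProb l) (probLength tr)) (sumW-map-∷ l v E))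
                                (sym (ℚ.*-distribˡ-+ (half^ (isProb l)) _ _))

sumW-map-deterministic : ∀ {l} v E → isProb l ≡ 0 → sumW (map ((l , v) ∷_) E) ≡ sumW E
sumW-map-deterministic v E z =
  trans (sumW-map-∷ _ v E) (trans (cong (λ k → half^ k * sumW E) z) (ℚ.*-identityˡ (sumW E)))

deterministic-deficit : ∀ {l} v E m → isProb l ≡ 0 → sumW E + half^ m ≤ 1ℚ →
                        sumW (map ((l , v) ∷_) E) + half^ (isProb l ℕ.+ m) ≤ 1ℚ
deterministic-deficit v E m z bound rewrite sumW-map-deterministic v E z | z = bound

½-convex : ∀ {x y} → x ≤ 1ℚ → y ≤ 1ℚ → ½ * x + ½ * y ≤ 1ℚ
½-convex x≤1 y≤1 = ℚ.+-mono-≤ (ℚ.*-monoˡ-≤-nonNeg ½ x≤1) (ℚ.*-monoˡ-≤-nonNeg ½ y≤1)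

½-convex-+ˡ : ∀ {x y} h → x + h ≤ 1ℚ → y ≤ 1ℚ → (½ * x + ½ * y) + ½ * h ≤ 1ℚ
½-convex-+ˡ {x} {y} h x+h≤1 y≤1 = subst (_≤ 1ℚ) (sym (regroup ½ x y h)) (½-convex x+h≤1 y≤1)
  where
  open +-*-Solver
  regroup : ∀ c x y h → (c * x + c * y) + c * h ≡ c * (x + h) + c * y
  regroup = solve 4 (λ c x y h → (c :* x :+ c :* y) :+ c :* h := c :* (x :+ h) :+ c :* y) refl

½-convex-+ʳ : ∀ {x y} h → x ≤ 1ℚ → y + h ≤ 1ℚ → (½ * x + ½ * y) + ½ * h ≤ 1ℚ
½-convex-+ʳ {x} {y} h x≤1 y+h≤1 =
  subst (λ w → w + ½ * h ≤ 1ℚ) (ℚ.+-comm (½ * y) (½ * x)) (½-convex-+ˡ {y} {x} h y+h≤1 x≤1)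

-<⇒<+ : ∀ {p q r} → p - r < q → p < q + r
-<⇒<+ {p} {q} {r} p-r<q = subst (_< q + r) p-r+r≡p (ℚ.+-monoˡ-< r p-r<q)
  where
  open +-*-Solver
  p-r+r≡p : (p - r) + r ≡ p
  p-r+r≡p = solve 2 (λ p r → (p :- r) :+ r := p) refl p r

StartsWith : Label × Tm → Trace → Set
StartsWith h tr = ∃ λ tr′ → tr ≡ h ∷ tr′

strip-first : ∀ h E → All (StartsWith h) E → ∃ λ E′ → E ≡ map (h ∷_) E′
strip-first h []      []                   = [] , refl
strip-first h (_ ∷ E) ((tr′ , refl) ∷ hs) with strip-first h E hs
... | E′ , refl = tr′ ∷ E′ , refl

record FirstStepSplit (h₁ h₂ : Label × Tm) (E : List Trace) : Set₁ where
  field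
    E₁ E₂        : List Trace
    sumW-split   : sumW E ≡ sumW (map (h₁ ∷_) E₁) + sumW (map (h₂ ∷_) E₂)
    All-split    : ∀ {P : Trace → Set} → All P E →
                   All (P ∘ (h₁ ∷_)) E₁ × All (P ∘ (h₂ ∷_)) E₂
    Unique-split : Unique E → Unique E₁ × Unique E₂

split-first : ∀ h₁ h₂ E → All (λ tr → StartsWith h₁ tr ⊎ StartsWith h₂ tr) E →
              FirstStepSplit h₁ h₂ E
split-first h₁ h₂ [] [] = record
  { E₁ = [] ; E₂ = [] ; sumW-split = refl
  ; All-split = λ _ → [] , [] ; Unique-split = λ _ → [] , [] }
split-first h₁ h₂ (_ ∷ E) (inj₁ (tr , refl) ∷ hs) = record
  { E₁ = tr ∷ E₁ ; E₂ = E₂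
  ; sumW-split = trans (cong (w +_) sumW-split) (sym (ℚ.+-assoc w _ _))
  ; All-split = λ { (p ∷ ps) → p ∷ proj₁ (All-split ps) , proj₂ (All-split ps) }
  ; Unique-split = λ { (tr∉ ∷ uq) →
      All.map (_∘ cong (h₁ ∷_)) (proj₁ (All-split tr∉)) ∷ proj₁ (Unique-split uq)
      , proj₂ (Unique-split uq) }
  }
  where
  open FirstStepSplit (split-first h₁ h₂ E hs)
  w = half^ (probLength (h₁ ∷ tr))
split-first h₁ h₂ (_ ∷ E) (inj₂ (tr , refl) ∷ hs) = record
  { E₁ = E₁ ; E₂ = tr ∷ E₂
  ; sumW-split = trans (cong (w +_) sumW-split)
                       (x∙yz≈y∙xz w (sumW (map (h₁ ∷_) E₁)) (sumW (map (h₂ ∷_) E₂)))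
  ; All-split = λ { (p ∷ ps) → proj₁ (All-split ps) , p ∷ proj₂ (All-split ps) }
  ; Unique-split = λ { (tr∉ ∷ uq) →
      proj₁ (Unique-split uq)
      , All.map (_∘ cong (h₂ ∷_)) (proj₂ (All-split tr∉)) ∷ proj₂ (Unique-split uq) }
  }
  where
  open FirstStepSplit (split-first h₁ h₂ E hs)
  w = half^ (probLength (h₂ ∷ tr))

sumW-split-choice : ∀ {a b E} (S : FirstStepSplit (probl , a) (probr , b) E) →
                    sumW E ≡ ½ * sumW (FirstStepSplit.E₁ S) + ½ * sumW (FirstStepSplit.E₂ S)
sumW-split-choice {a} {b} S =
  trans sumW-split (cong₂ _+_ (sumW-map-∷ probl a E₁) (sumW-map-∷ probr b E₂))
  where open FirstStepSplit S

IsEval-tail : ∀ {u l v tr} → IsEval u ((l , v) ∷ tr) → IsEval v tr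
IsEval-tail (ev-step _ ev) = ev

WHNF-IsEval : ∀ {u tr} → WHNF u → IsEval u tr → tr ≡ []
WHNF-IsEval _ (ev-done _)    = refl
WHNF-IsEval w (ev-step st _) = ⊥-elim (WHNF-irreducible w st)

deterministic-first-step : ∀ {u l v} → Step l u v → OnlyStep u (l , v) →
                           ∀ {tr} → IsEval u tr → StartsWith (l , v) tr
deterministic-first-step st _    (ev-done w)     = ⊥-elim (WHNF-irreducible w st)
deterministic-first-step _  only (ev-step st′ _) with only st′
... | refl = _ , refl

choice-first-step : ∀ {u a b} → Step probl u a → OnlySteps u (probl , a) (probr , b) →
                    ∀ {tr} → IsEval u tr → StartsWith (probl , a) tr ⊎ StartsWith (probr , b) tr
choice-first-step sa _    (ev-done w)     = ⊥-elim (WHNF-irreducible w sa)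
choice-first-step _  only (ev-step st′ _) with only st′
... | inj₁ refl = inj₁ (_ , refl)
... | inj₂ refl = inj₂ (_ , refl)

choice-split : ∀ {u a b} → Step probl u a → OnlySteps u (probl , a) (probr , b) →
               ∀ E → All (IsEval u) E → FirstStepSplit (probl , a) (probr , b) E
choice-split sa only E evs = split-first _ _ E (All.map (choice-first-step sa only) evs)

Converges : Tm → Set
Converges t = ∃ λ t′ → t ⟶sr* t′ × WHNF t′

IsEval-converges : ∀ {t tr} → IsEval t tr → Converges t
IsEval-converges (ev-done w)     = _ , ε , w
IsEval-converges (ev-step st ev) with IsEval-converges ev
... | t′ , steps , w = t′ , (_ , st) ◅ steps , w

bounded-evaluations-sumW≤1 : ∀ n {u} E → All (λ tr → length tr ℕ.≤ n) E → Unique E →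
                             All (IsEval u) E → sumW E ≤ 1ℚ
bounded-evaluations-sumW≤1 n [] _ _ _ = ℚ.nonNegative⁻¹ 1ℚ
bounded-evaluations-sumW≤1 n ([] ∷ []) _ _ (ev-done _ ∷ []) = ℚ.≤-refl
bounded-evaluations-sumW≤1 n ([] ∷ _ ∷ _) _ ((tr≢ ∷ _) ∷ _) (ev-done w ∷ ev ∷ _) =
  ⊥-elim (tr≢ (sym (WHNF-IsEval w ev)))
bounded-evaluations-sumW≤1 zero    (_ ∷ _) (() ∷ _) _ (ev-step _ _ ∷ _)
bounded-evaluations-sumW≤1 (suc n) {u} E lengths uq evs@(ev-step st _ ∷ _) =
  by-branching (branching st) E lengths uq evs
  where
  below : ∀ {l v} E′ → All (λ tr → length ((l , v) ∷ tr) ℕ.≤ suc n) E′ → Unique E′ →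
          All (λ tr → IsEval u ((l , v) ∷ tr)) E′ → sumW E′ ≤ 1ℚ
  below E′ lengths′ uq′ evs′ =
    bounded-evaluations-sumW≤1 n E′ (All.map ℕ.s≤s⁻¹ lengths′) uq′ (All.map IsEval-tail evs′)

  by-branching : Branching u → ∀ E → All (λ tr → length tr ℕ.≤ suc n) E → Unique E →
                 All (IsEval u) E → sumW E ≤ 1ℚ
  by-branching (deterministic z st₀ only) E lengths uq evs
    with strip-first _ E (All.map (deterministic-first-step st₀ only) evs)
  ... | E′ , refl = subst (_≤ 1ℚ) (sym (sumW-map-deterministic _ E′ z))
                      (below E′ (Allₚ.map⁻ lengths) (Uniqueₚ.map⁻ uq) (Allₚ.map⁻ evs))
  by-branching (choice sa only) E lengths uq evs =
    subst (_≤ 1ℚ) (sym (sumW-split-choice S))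
      (½-convex (below E₁ lengths₁ uq₁ evs₁) (below E₂ lengths₂ uq₂ evs₂))
    where
    S = choice-split sa only E evs
    open FirstStepSplit S
    lengths₁ = proj₁ (All-split lengths)
    lengths₂ = proj₂ (All-split lengths)
    uq₁      = proj₁ (Unique-split uq)
    uq₂      = proj₂ (Unique-split uq)
    evs₁     = proj₁ (All-split evs)
    evs₂     = proj₂ (All-split evs)

evaluations-sumW≤1 : ∀ {u} E → Unique E → All (IsEval u) E → sumW E ≤ 1ℚ
evaluations-sumW≤1 E = bounded-evaluations-sumW≤1 _ E (f[xs]≤f[argmax] [] E)

choice-deficitˡ : ∀ {u a b E} h (S : FirstStepSplit (probl , a) (probr , b) E) → Unique E →
                  All (IsEval u) E → sumW (FirstStepSplit.E₁ S) + h ≤ 1ℚ → sumW E + ½ * h ≤ 1ℚ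
choice-deficitˡ h S uq evs deficit₁ =
  subst (λ w → w + ½ * h ≤ 1ℚ) (sym (sumW-split-choice S))
    (½-convex-+ˡ {sumW E₁} {sumW E₂} h deficit₁ E₂-sumW≤1)
  where
  open FirstStepSplit S
  E₂-sumW≤1 : sumW E₂ ≤ 1ℚ
  E₂-sumW≤1 =
    evaluations-sumW≤1 E₂ (proj₂ (Unique-split uq)) (All.map IsEval-tail (proj₂ (All-split evs)))

choice-deficitʳ : ∀ {u a b E} h (S : FirstStepSplit (probl , a) (probr , b) E) → Unique E →
                  All (IsEval u) E → sumW (FirstStepSplit.E₂ S) + h ≤ 1ℚ → sumW E + ½ * h ≤ 1ℚ
choice-deficitʳ h S uq evs deficit₂ =
  subst (λ w → w + ½ * h ≤ 1ℚ) (sym (sumW-split-choice S))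
    (½-convex-+ʳ {sumW E₁} {sumW E₂} h E₁-sumW≤1 deficit₂)
  where
  open FirstStepSplit S
  E₁-sumW≤1 : sumW E₁ ≤ 1ℚ
  E₁-sumW≤1 =
    evaluations-sumW≤1 E₁ (proj₁ (Unique-split uq)) (All.map IsEval-tail (proj₁ (All-split evs)))

probLength* : ∀ {u t} → u ⟶sr* t → ℕ
probLength* ε             = 0
probLength* ((l , _) ◅ p) = isProb l ℕ.+ probLength* p

reduct-converges-or-deficit : ∀ {u t} (p : u ⟶sr* t) E → Unique E → All (IsEval u) E →
                              Converges t ⊎ sumW E + half^ (probLength* p) ≤ 1ℚ
reduct-converges-or-deficit ε [] _ _ = inj₂ ℚ.≤-refl
reduct-converges-or-deficit ε (_ ∷ _) _ (ev ∷ _) = inj₁ (IsEval-converges ev)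
reduct-converges-or-deficit {u} ((l , st) ◅ p) = by-branching (branching st)
  where
  m = probLength* p

  below : ∀ E′ → Unique E′ → All (λ tr → IsEval u ((l , _) ∷ tr)) E′ →
          Converges _ ⊎ sumW E′ + half^ m ≤ 1ℚ
  below E′ uq′ evs′ = reduct-converges-or-deficit p E′ uq′ (All.map IsEval-tail evs′)

  by-branching : Branching u → ∀ E → Unique E → All (IsEval u) E →
                 Converges _ ⊎ sumW E + half^ (isProb l ℕ.+ m) ≤ 1ℚ
  by-branching (deterministic z st₀ only) E uq evs
    with only st | strip-first _ E (All.map (deterministic-first-step st₀ only) evs)
  ... | refl | E′ , refl =
    Sum.map₂ (deterministic-deficit _ E′ m z) (below E′ (Uniqueₚ.map⁻ uq) (Allₚ.map⁻ evs))
  by-branching (choice sa only) E uq evs with only st | choice-split sa only E evs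
  ... | inj₁ refl | S = Sum.map₂ (choice-deficitˡ (half^ m) S uq evs)
                          (below _ (proj₁ (Unique-split S uq)) (proj₁ (All-split S evs)))
    where open FirstStepSplit using (Unique-split; All-split)
  ... | inj₂ refl | S = Sum.map₂ (choice-deficitʳ (half^ m) S uq evs)
                          (below _ (proj₂ (Unique-split S uq)) (proj₂ (All-split S evs)))
    where open FirstStepSplit using (Unique-split; All-split)

proposition2p15 : (s : Tm) → ExCv≡ s 1ℚ → ShouldConv s
proposition2p15 s (_ , approximable) t p
  with approximable (half^ (probLength* p)) (half^-positive (probLength* p))
... | E , uq , evs , 1-2^-m<sumW with reduct-converges-or-deficit p E uq evs
...   | inj₁ converges = converges
...   | inj₂ deficit   = ⊥-elim (ℚ.<-irrefl refl (ℚ.<-≤-trans (-<⇒<+ 1-2^-m<sumW) deficit))
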